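{- Let $W$ be a proper subspace of an $n$-dimensional vector space $V$ over $\mathbb{F}_q$ and let $T\in L(W,V)$. Let $U$ be the maximal $T$-invariant subspace, $d=\dim U$, and suppose $T\in\mathcal{C}(\lambda,\mathcal{I})$ for some partition $\lambda$ of $n-d$. Then the linear map $\hat{T}:W/U\to V/U$, $\hat{T}(v+U)=Tv+U$, is simple and has defect dimensions $\lambda$ and empty list of invariant factors, i.e. $\hat{T}\in\mathcal{C}(\lambda,\emptyset)$ (in $\mathcal{L}(V/U)$).
   Context: $\mathbb{F}_q$ is the finite field with $q$ elements. For a vector space $X$, $\mathcal{L}(X)$ is the union over subspaces $Y\subseteq X$ of the spaces $L(Y,X)$ of linear maps $Y\to X$. For $T\in L(Y,X)$ define $Y_0=X$, $Y_1=Y$, $Y_{i+1}=\{v\in Y_i:Tv\in Y_i\}$ ($i\ge1$), $d_i=\dim Y_i$, $\ell=\min\{i\ge0:Y_i=Y_{i+1}\}$; $Y_\ell$ is the maximal $T$-invariant subspace (largest $U\subseteq Y$ with $TU\subseteq U$); the defect dimensions are $\lambda_T=(d_0-d_1,\ldots,d_{\ell-1}-d_\ell)$ and $\mathcal{I}_T$ is the ordered list of invariant factors (monic $p_1\mid\cdots\mid p_r$, degree $\ge1$, with $Y_\ell\cong\bigoplus\mathbb{F}_q[x]/(p_i)$, $x$ acting as $T$) of $T$ restricted to $Y_\ell$. $\mathcal{C}(\lambda,\mathcal{I})=\{T\in\mathcal{L}(X):\lambda_T=\lambda,\mathcal{I}_T=\mathcal{I}\}$, and $\emptyset$ denotes the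 empty list. $T\in\mathcal{L}(X)$ is simple if every $T$-invariant subspace is $\{0\}$ or $X$. -}

module Defs where

open import Level using (0ℓ)
open import Algebra.Bundles using (CommutativeRing)
open import Algebra.Module.Bundles using (Module)
open import Algebra.Module.Morphism.Structures using (module LeftModuleMorphisms)
open import Data.Nat using (ℕ; zero; suc; _+_; _∸_; _<_; _≤_)
open import Data.Fin using (Fin; toℕ)
import Data.Fin as Fin
open import Data.Nat.ListAction using (sum)
open import Data.List using (List; []; _∷_; length; lookup; zip; zipWith; concat)
open import Data.List.Relation.Unary.All using (All)
open import Data.List.Relation.Unary.Any using (Any)
open import Data.List.Relation.Unary.AllPairs using (AllPairs)
open import Data.List.Relation.Unary.Linked using (Linked)
open import Data.Product using (Σ; _×_; _,_; ∃; ∃₂; proj₁; proj₂)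
open import Data.Sum using (_⊎_)
open import Data.Unit using (⊤)
open import Relation.Nullary using (¬_)
open import Relation.Binary.PropositionalEquality using (_≡_)

module _ (R : CommutativeRing 0ℓ 0ℓ) where
  open CommutativeRing R

  record IsField : Set where
    field
      nontrivial : ¬ (1# ≈ 0#)
      inverse    : ∀ x → ¬ (x ≈ 0#) → ∃ λ y → (x * y) ≈ 1#

  HasSize : ℕ → Set
  HasSize q = Σ (List Carrier) λ xs →
    length xs ≡ q × (∀ x → Any (x ≈_) xs) × AllPairs (λ a b → ¬ (a ≈ b)) xs

-- Used both for a genuine module V and for quotients V/U, which share
-- the carrier of V but use the equality  x ≈ y  iff  x - y ∈ U.

record Raw (R : CommutativeRing 0ℓ 0ℓ) : Set₁ where
  open CommutativeRing R using () renaming (Carrier to K)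
  infix 4 _≈_
  infixl 6 _+v_
  infixr 7 _·_
  field
    Carrier : Set
    _≈_     : Carrier → Carrier → Set
    0v      : Carrier
    _+v_    : Carrier → Carrier → Carrier
    -v_     : Carrier → Carrier
    _·_     : K → Carrier → Carrier

toRaw : {R : CommutativeRing 0ℓ 0ℓ} → Module R 0ℓ 0ℓ → Raw R
toRaw V = record
  { Carrier = Carrierᴹ ; _≈_ = _≈ᴹ_ ; 0v = 0ᴹ ; _+v_ = _+ᴹ_ ; -v_ = -ᴹ_ ; _·_ = _*ₗ_ }
  where open Module V

IsLinear : {R : CommutativeRing 0ℓ 0ℓ} (V : Module R 0ℓ 0ℓ) →
           (Module.Carrierᴹ V → Module.Carrierᴹ V) → Set
IsLinear V T = IsLeftModuleHomomorphism T
  where open LeftModuleMorphisms (Module.rawLeftModule V) (Module.rawLeftModule V)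

quot : {R : CommutativeRing 0ℓ 0ℓ} (X : Raw R) → (Raw.Carrier X → Set) → Raw R
quot X U = record
  { Carrier = Carrier ; _≈_ = λ x y → U (x +v (-v y))
  ; 0v = 0v ; _+v_ = _+v_ ; -v_ = -v_ ; _·_ = _·_ }
  where open Raw X

module _ {R : CommutativeRing 0ℓ 0ℓ} (X : Raw R) where
  open CommutativeRing R using (0#; 1#) renaming (Carrier to K; _≈_ to _≈K_; _+_ to _+K_; _*_ to _*K_)
  open Raw X

  Pred : Set₁
  Pred = Carrier → Set

  Full : Pred
  Full _ = ⊤

  Zero : Pred
  Zero v = v ≈ 0v

  _⊆_ : Pred → Pred → Set
  P ⊆ Q = ∀ v → P v → Q v

  _≐_ : Pred → Pred → Set
  P ≐ Q = (P ⊆ Q) × (Q ⊆ P)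

  record Subspace : Set₁ where
    field
      pred  : Pred
      resp  : ∀ {x y} → x ≈ y → pred x → pred y
      has0  : pred 0v
      add   : ∀ {x y} → pred x → pred y → pred (x +v y)
      scal  : ∀ c {x} → pred x → pred (c · x)
  open Subspace public

  lincomb : (vs : List Carrier) → (Fin (length vs) → K) → Carrier
  lincomb []       c = 0v
  lincomb (v ∷ vs) c = (c Fin.zero · v) +v lincomb vs (λ i → c (Fin.suc i))

  LinIndep : List Carrier → Set
  LinIndep vs = ∀ c → lincomb vs c ≈ 0v → ∀ i → c i ≈K 0#

  Spans : Pred → List Carrier → Set
  Spans P vs = ∀ v → P v → ∃ λ c → v ≈ lincomb vs c

  IsBasis : Pred → List Carrier → Set
  IsBasis P vs = All P vs × LinIndep vs × Spans P vs

  HasDim : Pred → ℕ → Set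
  HasDim P d = Σ (List Carrier) λ vs → length vs ≡ d × IsBasis P vs

  -- For T ∈ L(Y, X) (T given as a map on the carrier; only its values
  -- on Y are ever used):  Y_0 = X, Y_1 = Y, Y_{i+1} = {v ∈ Y_i : T v ∈ Y_i}.
  Yseq : Pred → (Carrier → Carrier) → ℕ → Pred
  Yseq Y T zero          = Full
  Yseq Y T (suc zero)    = Y
  Yseq Y T (suc (suc i)) = λ v → Yseq Y T (suc i) v × Yseq Y T (suc i) (T v)

  IsStabIndex : Pred → (Carrier → Carrier) → ℕ → Set
  IsStabIndex Y T ℓ = (Yseq Y T ℓ ≐ Yseq Y T (suc ℓ))
                    × (∀ i → i < ℓ → ¬ (Yseq Y T i ≐ Yseq Y T (suc i)))

  DefectDims : Pred → (Carrier → Carrier) → List ℕ → Set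
  DefectDims Y T λs = Σ ℕ λ ℓ → IsStabIndex Y T ℓ × length λs ≡ ℓ ×
    (∀ (i : Fin (length λs)) → ∃₂ λ a b →
        HasDim (Yseq Y T (toℕ i)) a × HasDim (Yseq Y T (suc (toℕ i))) b ×
        lookup λs i + b ≡ a)

  Simple : Pred → (Carrier → Carrier) → Set₁
  Simple Y T = ∀ (S : Subspace) → pred S ⊆ Y → (∀ v → pred S v → pred S (T v)) →
               (pred S ≐ Zero) ⊎ (pred S ≐ Full)

  IsMaxInvariant : Pred → (Carrier → Carrier) → Subspace → Set₁
  IsMaxInvariant Y T U = (pred U ⊆ Y) × (∀ v → pred U v → pred U (T v)) ×
    (∀ (S : Subspace) → pred S ⊆ Y → (∀ v → pred S v → pred S (T v)) → pred S ⊆ pred U)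

  -- Polynomials over R as coefficient lists (constant term first).

  Poly : Set
  Poly = List K

  coeff : Poly → ℕ → K
  coeff []       _       = 0#
  coeff (a ∷ p)  zero    = a
  coeff (a ∷ p)  (suc k) = coeff p k

  sumUpTo : ℕ → (ℕ → K) → K
  sumUpTo zero    f = f zero
  sumUpTo (suc k) f = sumUpTo k f +K f (suc k)

  PolyDivides : Poly → Poly → Set
  PolyDivides p r = ∃ λ (s : Poly) →
    ∀ k → sumUpTo k (λ i → coeff p i *K coeff s (k ∸ i)) ≈K coeff r k

  MonicPos : Poly → Set
  MonicPos p = (2 ≤ length p) × (coeff p (length p ∸ 1) ≈K 1#)

  deg : Poly → ℕ
  deg p = length p ∸ 1

  evalAt : (Carrier → Carrier) → Poly → Carrier → Carrier
  evalAt T []      v = 0v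
  evalAt T (a ∷ p) v = (a · v) +v evalAt T p (T v)

  krylov : (Carrier → Carrier) → Carrier → ℕ → List Carrier
  krylov T g zero    = []
  krylov T g (suc k) = g ∷ krylov T (T g) k

  -- I_T = I: I = [p_1, ..., p_r] monic of degree ≥ 1 with p_1 ∣ ... ∣ p_r,
  -- and Y_ℓ ≅ ⊕ K[x]/(p_i) as K[x]-modules (x acting as T).  Such an
  -- isomorphism is given by the images g_i ∈ Y_ℓ of the generators 1 of
  -- the summands: it is well defined iff p_i(T) g_i = 0, and bijective iff
  -- the vectors T^j g_i (j < deg p_i) form a basis of Y_ℓ.
  InvFactors : Pred → (Carrier → Carrier) → List Poly → Set
  InvFactors Y T I = Σ ℕ λ ℓ → IsStabIndex Y T ℓ ×
    All MonicPos I × Linked PolyDivides I ×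
    Σ (List Carrier) λ gs → length gs ≡ length I ×
      All (λ pg → Yseq Y T ℓ (proj₂ pg) × evalAt T (proj₁ pg) (proj₂ pg) ≈ 0v) (zip I gs) ×
      IsBasis (Yseq Y T ℓ) (concat (zipWith (λ p g → krylov T g (deg p)) I gs))

  InClass : Pred → (Carrier → Carrier) → List ℕ → List Poly → Set
  InClass Y T λs I = DefectDims Y T λs × InvFactors Y T I

IsPartition : List ℕ → ℕ → Set
IsPartition λs m = (sum λs ≡ m) × All (λ k → 0 < k) λs × Linked (λ a b → b ≤ a) λs

module Submission where

-- Every subspace of V/U that is invariant under the induced map lifts to a T-invariant subspace
-- of W, which lies in U by maximality: so the induced map is simple. Its defect sequence is that
-- of T read modulo U; every Y_i contains U, so dim (Y_i/U) = dim Y_i − dim U and the defect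
-- dimensions do not change. The stable term Y_ℓ is T-invariant, hence inside U, so modulo U the
-- maximal invariant subspace is zero and there are no invariant factors. Quotient dimensions are
-- computed by extending a basis of U inside Y_i; the exchange bound this needs comes from
-- counting coefficient vectors over the finite field.

open import Defs
open import Level using (0ℓ)
open import Algebra.Bundles using (CommutativeRing; CommutativeMonoid)
open import Algebra.Module.Bundles using (Module)
open import Algebra.Module.Morphism.Structures using (module LeftModuleMorphisms)
import Algebra.Properties.AbelianGroup as AbelianGroupProperties
import Algebra.Properties.CommutativeSemigroup as CommutativeSemigroupProperties
import Algebra.Properties.Group as GroupProperties
import Algebra.Properties.Ring as RingProperties
open import Data.Empty using (⊥-elim)
open import Data.Fin using (Fin; zero; suc; toℕ; funToFin; finToFun; combine)
import Data.Fin.Properties as Fin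
open import Data.List using (List; []; _∷_; _++_; [_]; length; lookup)
open import Data.List.Membership.Propositional.Properties using (∈-lookup)
open import Data.List.Properties using (++-assoc; length-++)
open import Data.List.Relation.Unary.All as All using (All; []; _∷_)
open import Data.List.Relation.Unary.All.Properties using (++⁻ˡ)
open import Data.List.Relation.Unary.AllPairs using (AllPairs; _∷_)
open import Data.List.Relation.Unary.Any as Any using (Any)
open import Data.List.Relation.Unary.Any.Properties using (lookup-index)
import Data.List.Relation.Unary.Linked as Linked
open import Data.Nat using (ℕ; _∸_; _+_; _^_; _≤_; s≤s; z≤n)
import Data.Nat.Properties as ℕ
open import Data.Product using (_×_; ∃; ∃₂; _,_; proj₁; proj₂)
open import Data.Sum using (inj₁)
open import Data.Unit using (tt)
open import Function using (_∘_; _∘′_)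
open import Function.Definitions using (Injective)
open import Relation.Binary.Definitions using (Decidable)
import Relation.Binary.Reasoning.Setoid as SetoidReasoning
open import Relation.Binary.PropositionalEquality as ≡ using (_≡_; refl)
open import Relation.Nullary using (¬_; Dec; yes; no)
open import Relation.Nullary.Decidable using (map′)

funToFin-cong : ∀ {m n} {f g : Fin m → Fin n} → (∀ i → f i ≡ g i) → funToFin f ≡ funToFin g
funToFin-cong {ℕ.zero}  f≗g = refl
funToFin-cong {ℕ.suc m} f≗g = ≡.cong₂ combine (f≗g zero) (funToFin-cong (f≗g ∘ suc))

distinct⇒2≤ : ∀ {n} {i j : Fin n} → ¬ i ≡ j → 2 ≤ n
distinct⇒2≤ {1}            {zero} {zero} i≢j = ⊥-elim (i≢j refl)
distinct⇒2≤ {ℕ.suc (ℕ.suc n)}             _ = s≤s (s≤s z≤n)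

difference-invariant : ∀ {k a b a′ b′} d → a′ + d ≡ a → b′ + d ≡ b → k + b ≡ a → k + b′ ≡ a′
difference-invariant {k} {a} {b} {a′} {b′} d a′+d≡a b′+d≡b k+b≡a = ℕ.+-cancelʳ-≡ d _ _ (begin
  k + b′ + d    ≡⟨ ℕ.+-assoc k b′ d ⟩
  k + (b′ + d)  ≡⟨ ≡.cong (k +_) b′+d≡b ⟩
  k + b         ≡⟨ k+b≡a ⟩
  a             ≡⟨ a′+d≡a ⟨
  a′ + d        ∎)
  where open ≡.≡-Reasoning

module Enumeration (R : CommutativeRing 0ℓ 0ℓ) {q : ℕ} (size : HasSize R q) where
  open CommutativeRing R using (Carrier; _≈_; 0#; 1#; sym; trans; reflexive)

  elems : List Carrier
  elems = proj₁ size

  private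
    covers : ∀ x → Any (x ≈_) elems
    covers = proj₁ (proj₂ (proj₂ size))

    lookup-injective′ : ∀ {ys} → AllPairs (λ a b → ¬ a ≈ b) ys →
                        ∀ i j → lookup ys i ≈ lookup ys j → i ≡ j
    lookup-injective′ (y≉ ∷ _)  zero    zero    _ = refl
    lookup-injective′ (y≉ ∷ _)  zero    (suc j) e = ⊥-elim (All.lookup y≉ (∈-lookup j) e)
    lookup-injective′ (y≉ ∷ _)  (suc i) zero    e = ⊥-elim (All.lookup y≉ (∈-lookup i) (sym e))
    lookup-injective′ (_ ∷ ys#) (suc i) (suc j) e = ≡.cong suc (lookup-injective′ ys# i j e)

  lookup-injective : ∀ i j → lookup elems i ≈ lookup elems j → i ≡ j
  lookup-injective = lookup-injective′ (proj₂ (proj₂ (proj₂ size)))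

  index : Carrier → Fin (length elems)
  index x = Any.index (covers x)

  ≈-lookup-index : ∀ x → x ≈ lookup elems (index x)
  ≈-lookup-index x = lookup-index (covers x)

  index-cong : ∀ {x y} → x ≈ y → index x ≡ index y
  index-cong {x} {y} x≈y =
    lookup-injective _ _ (trans (sym (≈-lookup-index x)) (trans x≈y (≈-lookup-index y)))

  index-injective : ∀ {x y} → index x ≡ index y → x ≈ y
  index-injective {x} {y} eq =
    trans (≈-lookup-index x) (trans (reflexive (≡.cong (lookup elems) eq)) (sym (≈-lookup-index y)))

  index-lookup : ∀ i → index (lookup elems i) ≡ i
  index-lookup i = lookup-injective _ _ (sym (≈-lookup-index (lookup elems i)))

  _≟_ : Decidable _≈_
  x ≟ y = map′ index-injective index-cong (index x Fin.≟ index y)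

  2≤size : ¬ 1# ≈ 0# → 2 ≤ length elems
  2≤size 1≉0 = distinct⇒2≤ (1≉0 ∘ index-injective)

  encode : ∀ {m} → (Fin m → Carrier) → Fin (length elems ^ m)
  encode c = funToFin (index ∘ c)

  decode : ∀ {m} → Fin (length elems ^ m) → Fin m → Carrier
  decode t i = lookup elems (finToFun t i)

  encode-cong : ∀ {m} {c c′ : Fin m → Carrier} → (∀ i → c i ≈ c′ i) → encode c ≡ encode c′
  encode-cong c≈c′ = funToFin-cong (index-cong ∘ c≈c′)

  encode-injective : ∀ {m} {c c′ : Fin m → Carrier} → encode c ≡ encode c′ → ∀ i → c i ≈ c′ i
  encode-injective {c = c} {c′} eq i = index-injective (begin
    index (c i)                 ≡⟨ Fin.finToFun-funToFin (index ∘ c) i ⟨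
    finToFun (encode c) i       ≡⟨ ≡.cong (λ t → finToFun t i) eq ⟩
    finToFun (encode c′) i      ≡⟨ Fin.finToFun-funToFin (index ∘ c′) i ⟩
    index (c′ i)                ∎)
    where open ≡.≡-Reasoning

  decode-encode : ∀ {m} (c : Fin m → Carrier) i → c i ≈ decode (encode c) i
  decode-encode c i = trans (≈-lookup-index (c i))
    (reflexive (≡.cong (lookup elems) (≡.sym (Fin.finToFun-funToFin (index ∘ c) i))))

  encode-decode : ∀ {m} (t : Fin (length elems ^ m)) → encode (decode {m} t) ≡ t
  encode-decode {m} t = ≡.trans (funToFin-cong {m} (index-lookup ∘ finToFun t)) (Fin.funToFin-finToFin {m} t)

module Combinations {R : CommutativeRing 0ℓ 0ℓ} (V : Module R 0ℓ 0ℓ) where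
  open CommutativeRing R using (_*_; -_; 0#; 1#; -‿inverseˡ; ring)
    renaming (Carrier to K; _+_ to _+ᴷ_; _≈_ to _≈ᴷ_; sym to ≈ᴷ-sym)
  open Module V
  open SetoidReasoning ≈ᴹ-setoid
  open AbelianGroupProperties +ᴹ-abelianGroup using (xyx⁻¹≈y)
  open CommutativeSemigroupProperties (CommutativeMonoid.commutativeSemigroup +ᴹ-commutativeMonoid)
    using (interchange)
  open GroupProperties +ᴹ-group using (x≈y⇒x∙y⁻¹≈ε; inverseˡ-unique; ε⁻¹≈ε)

  X : Raw R
  X = toRaw V

  M : Set
  M = Carrierᴹ

  Coeffs : List M → Set
  Coeffs vs = Fin (length vs) → K

  ⟨_⟩ : List M → M → Set
  ⟨ vs ⟩ v = ∃ λ (c : Coeffs vs) → v ≈ᴹ lincomb X vs c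

  x-0≈x : ∀ x → x +ᴹ -ᴹ 0ᴹ ≈ᴹ x
  x-0≈x x = ≈ᴹ-trans (+ᴹ-congˡ ε⁻¹≈ε) (+ᴹ-identityʳ x)

  ≈x+y⇒-x≈y : ∀ {v x y} → v ≈ᴹ x +ᴹ y → v +ᴹ -ᴹ x ≈ᴹ y
  ≈x+y⇒-x≈y {v} {x} {y} v≈x+y = ≈ᴹ-trans (+ᴹ-congʳ v≈x+y) (xyx⁻¹≈y x y)

  -ᴹ≈-1*ₗ : ∀ x → -ᴹ x ≈ᴹ (- 1#) *ₗ x
  -ᴹ≈-1*ₗ x = ≈ᴹ-sym (inverseˡ-unique ((- 1#) *ₗ x) x (begin
    (- 1#) *ₗ x +ᴹ x        ≈⟨ +ᴹ-congˡ (≈ᴹ-sym (*ₗ-identityˡ x)) ⟩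
    (- 1#) *ₗ x +ᴹ 1# *ₗ x  ≈⟨ ≈ᴹ-sym (*ₗ-distribʳ x (- 1#) 1#) ⟩
    ((- 1#) +ᴷ 1#) *ₗ x     ≈⟨ *ₗ-congʳ (-‿inverseˡ 1#) ⟩
    0# *ₗ x                 ≈⟨ *ₗ-zeroˡ x ⟩
    0ᴹ                      ∎))

  lincomb-cong : ∀ vs {c c′ : Coeffs vs} → (∀ i → c i ≈ᴷ c′ i) → lincomb X vs c ≈ᴹ lincomb X vs c′
  lincomb-cong []       _     = ≈ᴹ-refl
  lincomb-cong (v ∷ vs) c≈c′ = +ᴹ-cong (*ₗ-congʳ (c≈c′ zero)) (lincomb-cong vs (c≈c′ ∘ suc))

  lincomb-0 : ∀ vs → lincomb X vs (λ _ → 0#) ≈ᴹ 0ᴹ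
  lincomb-0 []       = ≈ᴹ-refl
  lincomb-0 (v ∷ vs) = ≈ᴹ-trans (+ᴹ-cong (*ₗ-zeroˡ v) (lincomb-0 vs)) (+ᴹ-identityˡ 0ᴹ)

  lincomb-+ : ∀ vs (c c′ : Coeffs vs) →
              lincomb X vs (λ i → c i +ᴷ c′ i) ≈ᴹ lincomb X vs c +ᴹ lincomb X vs c′
  lincomb-+ []       c c′ = ≈ᴹ-sym (+ᴹ-identityˡ 0ᴹ)
  lincomb-+ (v ∷ vs) c c′ = begin
    (c zero +ᴷ c′ zero) *ₗ v +ᴹ lincomb X vs (λ i → c (suc i) +ᴷ c′ (suc i))
      ≈⟨ +ᴹ-cong (*ₗ-distribʳ v (c zero) (c′ zero)) (lincomb-+ vs (c ∘ suc) (c′ ∘ suc)) ⟩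
    (c zero *ₗ v +ᴹ c′ zero *ₗ v) +ᴹ (lincomb X vs (c ∘ suc) +ᴹ lincomb X vs (c′ ∘ suc))
      ≈⟨ interchange _ _ _ _ ⟩
    (c zero *ₗ v +ᴹ lincomb X vs (c ∘ suc)) +ᴹ (c′ zero *ₗ v +ᴹ lincomb X vs (c′ ∘ suc)) ∎

  lincomb-* : ∀ vs k (c : Coeffs vs) → lincomb X vs (λ i → k * c i) ≈ᴹ k *ₗ lincomb X vs c
  lincomb-* []       k c = ≈ᴹ-sym (*ₗ-zeroʳ k)
  lincomb-* (v ∷ vs) k c = begin
    (k * c zero) *ₗ v +ᴹ lincomb X vs (λ i → k * c (suc i))
      ≈⟨ +ᴹ-cong (*ₗ-assoc k (c zero) v) (lincomb-* vs k (c ∘ suc)) ⟩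
    k *ₗ (c zero *ₗ v) +ᴹ k *ₗ lincomb X vs (c ∘ suc)
      ≈⟨ ≈ᴹ-sym (*ₗ-distribˡ k _ _) ⟩
    k *ₗ (c zero *ₗ v +ᴹ lincomb X vs (c ∘ suc)) ∎

  lincomb-neg : ∀ vs (c : Coeffs vs) → lincomb X vs (λ i → - c i) ≈ᴹ -ᴹ lincomb X vs c
  lincomb-neg vs c = begin
    lincomb X vs (λ i → - c i)           ≈⟨ lincomb-cong vs (λ i → ≈ᴷ-sym (-1*x≈-x (c i))) ⟩
    lincomb X vs (λ i → (- 1#) * c i)    ≈⟨ lincomb-* vs (- 1#) c ⟩
    (- 1#) *ₗ lincomb X vs c             ≈⟨ ≈ᴹ-sym (-ᴹ≈-1*ₗ _) ⟩
    -ᴹ lincomb X vs c                    ∎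
    where open RingProperties ring using (-1*x≈-x)

  lincomb-injective : ∀ {vs} → LinIndep X vs → ∀ (c c′ : Coeffs vs) →
                      lincomb X vs c ≈ᴹ lincomb X vs c′ → ∀ i → c i ≈ᴷ c′ i
  lincomb-injective {vs} independent c c′ eq i = GK.x∙y⁻¹≈ε⇒x≈y (c i) (c′ i)
    (independent (λ j → c j +ᴷ - c′ j) (begin
      lincomb X vs (λ j → c j +ᴷ - c′ j)            ≈⟨ lincomb-+ vs c (λ j → - c′ j) ⟩
      lincomb X vs c +ᴹ lincomb X vs (λ j → - c′ j) ≈⟨ +ᴹ-congˡ (lincomb-neg vs c′) ⟩
      lincomb X vs c +ᴹ -ᴹ lincomb X vs c′          ≈⟨ x≈y⇒x∙y⁻¹≈ε eq ⟩
      0ᴹ                                            ∎) i)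
    where module GK = GroupProperties (CommutativeRing.+-group R)

  lincomb-∈ : (S : Subspace X) → ∀ {vs} → All (pred S) vs → ∀ c → pred S (lincomb X vs c)
  lincomb-∈ S []         c = has0 S
  lincomb-∈ S (v∈ ∷ vs∈) c = add S (scal S (c zero) v∈) (lincomb-∈ S vs∈ (c ∘ suc))

  appendᶜ : ∀ as {bs} → Coeffs as → Coeffs bs → Coeffs (as ++ bs)
  appendᶜ []       ca cb i            = cb i
  appendᶜ (a ∷ as)      ca cb zero    = ca zero
  appendᶜ (a ∷ as) {bs} ca cb (suc i) = appendᶜ as {bs} (ca ∘ suc) cb i

  ↑ˡ : ∀ (as : List M) {bs : List M} → Fin (length as) → Fin (length (as ++ bs))
  ↑ˡ (a ∷ as) zero    = zero
  ↑ˡ (a ∷ as) (suc i) = suc (↑ˡ as i)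

  ↑ʳ : ∀ (as : List M) {bs : List M} → Fin (length bs) → Fin (length (as ++ bs))
  ↑ʳ []       i = i
  ↑ʳ (a ∷ as) i = suc (↑ʳ as i)

  appendᶜ-↑ˡ : ∀ as {bs} (ca : Coeffs as) (cb : Coeffs bs) i → appendᶜ as {bs} ca cb (↑ˡ as i) ≡ ca i
  appendᶜ-↑ˡ (a ∷ as)      ca cb zero    = refl
  appendᶜ-↑ˡ (a ∷ as) {bs} ca cb (suc i) = appendᶜ-↑ˡ as {bs} (ca ∘ suc) cb i

  lincomb-appendᶜ : ∀ as {bs} (ca : Coeffs as) (cb : Coeffs bs) →
                    lincomb X (as ++ bs) (appendᶜ as ca cb) ≈ᴹ lincomb X as ca +ᴹ lincomb X bs cb
  lincomb-appendᶜ []            ca cb = ≈ᴹ-sym (+ᴹ-identityˡ _)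
  lincomb-appendᶜ (a ∷ as) {bs} ca cb =
    ≈ᴹ-trans (+ᴹ-congˡ (lincomb-appendᶜ as {bs} (ca ∘ suc) cb)) (≈ᴹ-sym (+ᴹ-assoc _ _ _))

  lincomb-++ : ∀ as {bs} (c : Coeffs (as ++ bs)) →
               lincomb X (as ++ bs) c ≈ᴹ lincomb X as (c ∘′ ↑ˡ as) +ᴹ lincomb X bs (c ∘′ ↑ʳ as)
  lincomb-++ []            c = ≈ᴹ-sym (+ᴹ-identityˡ _)
  lincomb-++ (a ∷ as) {bs} c =
    ≈ᴹ-trans (+ᴹ-congˡ (lincomb-++ as {bs} (c ∘ suc))) (≈ᴹ-sym (+ᴹ-assoc _ _ _))

  ⟨⟩-++⁺ʳ : ∀ as {bs v} → ⟨ bs ⟩ v → ⟨ as ++ bs ⟩ v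
  ⟨⟩-++⁺ʳ as {bs} {v} (c , v≈) = appendᶜ as (λ _ → 0#) c , (begin
    v                                                ≈⟨ v≈ ⟩
    lincomb X bs c                                   ≈⟨ ≈ᴹ-sym (+ᴹ-identityˡ _) ⟩
    0ᴹ +ᴹ lincomb X bs c                             ≈⟨ +ᴹ-congʳ (≈ᴹ-sym (lincomb-0 as)) ⟩
    lincomb X as (λ _ → 0#) +ᴹ lincomb X bs c        ≈⟨ ≈ᴹ-sym (lincomb-appendᶜ as {bs} _ c) ⟩
    lincomb X (as ++ bs) (appendᶜ as (λ _ → 0#) c)   ∎)

  ∈⟨∷⟩ : ∀ b bs → ⟨ b ∷ bs ⟩ b
  ∈⟨∷⟩ b bs = (λ { zero → 1# ; (suc i) → 0# }) , (begin
    b                                ≈⟨ ≈ᴹ-sym (*ₗ-identityˡ b) ⟩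
    1# *ₗ b                          ≈⟨ ≈ᴹ-sym (+ᴹ-identityʳ _) ⟩
    1# *ₗ b +ᴹ 0ᴹ                    ≈⟨ +ᴹ-congˡ (≈ᴹ-sym (lincomb-0 bs)) ⟩
    1# *ₗ b +ᴹ lincomb X bs (λ _ → 0#) ∎)

  ⟨⟩-lincomb : ∀ {bs vs} → All ⟨ vs ⟩ bs → ∀ c → ⟨ vs ⟩ (lincomb X bs c)
  ⟨⟩-lincomb {[]}     {vs} []                   c = (λ _ → 0#) , ≈ᴹ-sym (lincomb-0 vs)
  ⟨⟩-lincomb {b ∷ bs} {vs} ((e , b≈) ∷ bs⊆⟨vs⟩) c with ⟨⟩-lincomb {bs} {vs} bs⊆⟨vs⟩ (c ∘ suc)
  ... | e′ , rest≈ = (λ i → c zero * e i +ᴷ e′ i) , (begin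
    c zero *ₗ b +ᴹ lincomb X bs (c ∘ suc)                   ≈⟨ +ᴹ-cong (*ₗ-congˡ b≈) rest≈ ⟩
    c zero *ₗ lincomb X vs e +ᴹ lincomb X vs e′             ≈⟨ +ᴹ-congʳ (≈ᴹ-sym (lincomb-* vs (c zero) e)) ⟩
    lincomb X vs (λ i → c zero * e i) +ᴹ lincomb X vs e′    ≈⟨ ≈ᴹ-sym (lincomb-+ vs (λ i → c zero * e i) e′) ⟩
    lincomb X vs (λ i → c zero * e i +ᴷ e′ i)               ∎)

  Spans-trans : ∀ {P : M → Set} {bs vs} → Spans X P bs → All ⟨ vs ⟩ bs → Spans X P vs
  Spans-trans {bs = bs} {vs} bs-spans bs⊆⟨vs⟩ v v∈P with bs-spans v v∈P
  ... | c , v≈ with ⟨⟩-lincomb {bs} {vs} bs⊆⟨vs⟩ c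
  ...   | e , lincomb≈ = e , ≈ᴹ-trans v≈ lincomb≈

  lincomb-quot : ∀ (U : M → Set) vs c → lincomb (quot X U) vs c ≡ lincomb X vs c
  lincomb-quot U []       c = refl
  lincomb-quot U (v ∷ vs) c = ≡.cong (c zero *ₗ v +ᴹ_) (lincomb-quot U vs (c ∘ suc))

  module _ (U : Subspace X) where

    quot-LinIndep : ∀ cs {us} → LinIndep X (cs ++ us) → Spans X (pred U) us →
                    LinIndep (quot X (pred U)) cs
    quot-LinIndep cs {us} independent us-spans c lincomb∈U i with us-spans (lincomb X cs c)
      (resp U (x-0≈x _) (≡.subst (λ z → pred U (z +ᴹ -ᴹ 0ᴹ)) (lincomb-quot (pred U) cs c) lincomb∈U))
    ... | e , lincomb≈ = ≡.subst (_≈ᴷ 0#) (appendᶜ-↑ˡ cs {us} c (λ j → - e j) i)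
      (independent (appendᶜ cs {us} c (λ j → - e j)) (begin
        lincomb X (cs ++ us) (appendᶜ cs {us} c (λ j → - e j)) ≈⟨ lincomb-appendᶜ cs {us} c _ ⟩
        lincomb X cs c +ᴹ lincomb X us (λ j → - e j)           ≈⟨ +ᴹ-congˡ (lincomb-neg us e) ⟩
        lincomb X cs c +ᴹ -ᴹ lincomb X us e                    ≈⟨ x≈y⇒x∙y⁻¹≈ε lincomb≈ ⟩
        0ᴹ                                                     ∎) (↑ˡ cs {us} i))

    quot-Spans : ∀ {P : M → Set} cs {us} → Spans X P (cs ++ us) → All (pred U) us →
                 Spans (quot X (pred U)) P cs
    quot-Spans cs {us} spans us⊆U v v∈P with spans v v∈P
    ... | c , v≈ = c ∘′ ↑ˡ cs {us} ,
      ≡.subst (λ z → pred U (v +ᴹ -ᴹ z)) (≡.sym (lincomb-quot (pred U) cs (c ∘′ ↑ˡ cs {us})))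
        (resp U (≈ᴹ-sym (≈x+y⇒-x≈y (≈ᴹ-trans v≈ (lincomb-++ cs {us} c))))
          (lincomb-∈ U us⊆U (c ∘′ ↑ʳ cs {us})))

    quot-Subspace⇒Subspace : Subspace (quot X (pred U)) → Subspace X
    quot-Subspace⇒Subspace S = record
      { pred = pred S
      ; resp = λ x≈y → resp S (resp U (≈ᴹ-sym (x≈y⇒x∙y⁻¹≈ε x≈y)) (has0 U))
      ; has0 = has0 S ; add = add S ; scal = scal S }

    U⊆quot-Subspace : (S : Subspace (quot X (pred U))) → ∀ v → pred U v → pred S v
    U⊆quot-Subspace S v v∈U = resp S {0ᴹ} (resp U -v≈0-v (scal U (- 1#) v∈U)) (has0 S)
      where
      -v≈0-v : (- 1#) *ₗ v ≈ᴹ 0ᴹ +ᴹ -ᴹ v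
      -v≈0-v = ≈ᴹ-trans (≈ᴹ-sym (-ᴹ≈-1*ₗ v)) (≈ᴹ-sym (+ᴹ-identityˡ _))

module FiniteDimension (R : CommutativeRing 0ℓ 0ℓ) (isField : IsField R) {q : ℕ} (size : HasSize R q)
                       (V : Module R 0ℓ 0ℓ) where
  open CommutativeRing R using (_*_; -_; 0#; 1#; *-comm)
    renaming (_≈_ to _≈ᴷ_; sym to ≈ᴷ-sym; trans to ≈ᴷ-trans)
  open Module V
  open SetoidReasoning ≈ᴹ-setoid
  open GroupProperties +ᴹ-group using (inverseˡ-unique)
  open Enumeration R size
  open Combinations V

  LinIndep-∷ : ∀ {b vs} → ¬ ⟨ vs ⟩ b → LinIndep X vs → LinIndep X (b ∷ vs)
  LinIndep-∷ {b} {vs} b∉⟨vs⟩ independent c lincomb≈0 = c≈0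
    where
    tail≈0 : c zero ≈ᴷ 0# → lincomb X vs (c ∘ suc) ≈ᴹ 0ᴹ
    tail≈0 c₀≈0 = begin
      lincomb X vs (c ∘ suc)               ≈⟨ ≈ᴹ-sym (+ᴹ-identityˡ _) ⟩
      0ᴹ +ᴹ lincomb X vs (c ∘ suc)         ≈⟨ +ᴹ-congʳ (≈ᴹ-trans (*ₗ-congʳ c₀≈0) (*ₗ-zeroˡ b)) ⟨
      c zero *ₗ b +ᴹ lincomb X vs (c ∘ suc) ≈⟨ lincomb≈0 ⟩
      0ᴹ                                   ∎

    b∈⟨vs⟩ : ¬ c zero ≈ᴷ 0# → ⟨ vs ⟩ b
    b∈⟨vs⟩ c₀≉0 with IsField.inverse isField (c zero) c₀≉0
    ... | y , c₀y≈1 = (λ i → y * - c (suc i)) , (begin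
      b                                   ≈⟨ ≈ᴹ-sym (*ₗ-identityˡ b) ⟩
      1# *ₗ b                             ≈⟨ *ₗ-congʳ (≈ᴷ-trans (≈ᴷ-sym c₀y≈1) (*-comm (c zero) y)) ⟩
      (y * c zero) *ₗ b                   ≈⟨ *ₗ-assoc y (c zero) b ⟩
      y *ₗ (c zero *ₗ b)                  ≈⟨ *ₗ-congˡ (inverseˡ-unique _ _ lincomb≈0) ⟩
      y *ₗ -ᴹ lincomb X vs (c ∘ suc)      ≈⟨ *ₗ-congˡ (≈ᴹ-sym (lincomb-neg vs (c ∘ suc))) ⟩
      y *ₗ lincomb X vs (λ i → - c (suc i)) ≈⟨ ≈ᴹ-sym (lincomb-* vs y _) ⟩
      lincomb X vs (λ i → y * - c (suc i))  ∎)

    c₀≈0 : c zero ≈ᴷ 0#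
    c₀≈0 with c zero ≟ 0#
    ... | yes c₀≈0 = c₀≈0
    ... | no  c₀≉0 = ⊥-elim (b∉⟨vs⟩ (b∈⟨vs⟩ c₀≉0))

    c≈0 : ∀ i → c i ≈ᴷ 0#
    c≈0 zero    = c₀≈0
    c≈0 (suc i) = independent (c ∘ suc) (tail≈0 c₀≈0) i

  -- Pigeonhole on coefficient vectors: c ↦ (coordinates of lincomb ls c over bs) is injective by
  -- independence, and there are |K|^|ls| of the former against |K|^|bs| of the latter.
  independent⇒length≤ : ∀ {ls bs} → LinIndep X ls → All ⟨ bs ⟩ ls → length ls ≤ length bs
  independent⇒length≤ {ls} {bs} independent ls⊆⟨bs⟩ = ℕ.≮⇒≥ λ bs<ls →
    ℕ.<⇒≱ (ℕ.^-monoʳ-< _ (2≤size (IsField.nontrivial isField)) bs<ls) (Fin.injective⇒≤ recode-injective)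
    where
    coordinates : Coeffs ls → Coeffs bs
    coordinates c = proj₁ (⟨⟩-lincomb {ls} {bs} ls⊆⟨bs⟩ c)

    recode : Fin (length elems ^ length ls) → Fin (length elems ^ length bs)
    recode = encode ∘ coordinates ∘ decode

    recode-injective : Injective _≡_ _≡_ recode
    recode-injective {t} {t′} eq = ≡.trans (≡.sym (encode-decode {length ls} t))
      (≡.trans (encode-cong (lincomb-injective {ls} independent _ _ same-lincomb)) (encode-decode {length ls} t′))
      where
      same-lincomb : lincomb X ls (decode t) ≈ᴹ lincomb X ls (decode t′)
      same-lincomb = begin
        lincomb X ls (decode t)                ≈⟨ proj₂ (⟨⟩-lincomb {ls} {bs} ls⊆⟨bs⟩ (decode t)) ⟩
        lincomb X bs (coordinates (decode t))  ≈⟨ lincomb-cong bs (encode-injective eq) ⟩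
        lincomb X bs (coordinates (decode t′)) ≈⟨ proj₂ (⟨⟩-lincomb {ls} {bs} ls⊆⟨bs⟩ (decode t′)) ⟨
        lincomb X ls (decode t′)               ∎

  module _ {n : ℕ} (dimV : HasDim X (Full X) n) where
    private
      E : List M
      E = proj₁ dimV

      E-independent : LinIndep X E
      E-independent = proj₁ (proj₂ (proj₂ (proj₂ dimV)))

      coordinates : M → Coeffs E
      coordinates v = proj₁ (proj₂ (proj₂ (proj₂ (proj₂ dimV))) v tt)

      ≈coordinates : ∀ v → v ≈ᴹ lincomb X E (coordinates v)
      ≈coordinates v = proj₂ (proj₂ (proj₂ (proj₂ (proj₂ dimV))) v tt)

    _≟ᴹ_ : Decidable _≈ᴹ_
    v ≟ᴹ w = map′
      (λ same → ≈ᴹ-trans (≈coordinates v) (≈ᴹ-trans (lincomb-cong E same) (≈ᴹ-sym (≈coordinates w))))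
      (λ v≈w → lincomb-injective {E} E-independent _ _
                 (≈ᴹ-trans (≈ᴹ-sym (≈coordinates v)) (≈ᴹ-trans v≈w (≈coordinates w))))
      (Fin.all? λ i → coordinates v i ≟ coordinates w i)

    ⟨_⟩? : ∀ vs v → Dec (⟨ vs ⟩ v)
    ⟨ vs ⟩? v = map′
      (λ (t , v≈) → decode t , v≈)
      (λ (c , v≈) → encode c , ≈ᴹ-trans v≈ (lincomb-cong vs (decode-encode c)))
      (Fin.any? λ t → v ≟ᴹ lincomb X vs (decode t))

    extend : ∀ {P : M → Set} vs → LinIndep X vs → All P vs → ∀ bs → All P bs →
             ∃ λ cs → LinIndep X (cs ++ vs) × All P (cs ++ vs) × All ⟨ cs ++ vs ⟩ bs
    extend vs independent vs⊆P []       []            = [] , independent , vs⊆P , []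
    extend vs independent vs⊆P (b ∷ bs) (b∈P ∷ bs⊆P) with ⟨ vs ⟩? b
    ... | yes b∈⟨vs⟩ =
      let cs , independent′ , ⊆P , bs⊆⟨⟩ = extend vs independent vs⊆P bs bs⊆P
      in  cs , independent′ , ⊆P , ⟨⟩-++⁺ʳ cs {vs} b∈⟨vs⟩ ∷ bs⊆⟨⟩
    ... | no  b∉⟨vs⟩ =
      let cs , independent′ , ⊆P , bs⊆⟨⟩ =
            extend (b ∷ vs) (LinIndep-∷ {b} {vs} b∉⟨vs⟩ independent) (b∈P ∷ vs⊆P) bs bs⊆P
      in  cs ++ [ b ] ,
          ≡.subst (λ ws → LinIndep X ws × All _ ws × All ⟨ ws ⟩ (b ∷ bs)) (≡.sym (++-assoc cs [ b ] vs))
            (independent′ , ⊆P , ⟨⟩-++⁺ʳ cs (∈⟨∷⟩ b vs) ∷ bs⊆⟨⟩)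

    quotient-dim : (U P : Subspace X) → (∀ v → pred U v → pred P v) → ∀ {d a} →
                   HasDim X (pred U) d → HasDim X (pred P) a →
                   ∃ λ a′ → HasDim (quot X (pred U)) (pred P) a′ × a′ + d ≡ a
    quotient-dim U P U⊆P (us , refl , us⊆U , us-independent , us-spans)
                         (bs , refl , bs⊆P , bs-independent , bs-spans)
      with extend us us-independent (All.map (U⊆P _) us⊆U) bs bs⊆P
    ... | cs , independent , ⊆P , bs⊆⟨⟩ =
      length cs ,
      (cs , refl , ++⁻ˡ cs ⊆P , quot-LinIndep U cs independent us-spans , quot-Spans U cs spans us⊆U) ,
      ≡.trans (≡.sym (length-++ cs))
        (ℕ.≤-antisym (independent⇒length≤ {cs ++ us} {bs} independent (All.map (bs-spans _) ⊆P))
                     (independent⇒length≤ {bs} {cs ++ us} bs-independent bs⊆⟨⟩))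
      where
      spans : Spans X (pred P) (cs ++ us)
      spans = Spans-trans {bs = bs} {cs ++ us} bs-spans bs⊆⟨⟩

HasDim-≐ : ∀ {R : CommutativeRing 0ℓ 0ℓ} (X : Raw R) {P P′ : Pred X} {a} →
           _≐_ X P P′ → HasDim X P a → HasDim X P′ a
HasDim-≐ X (P⊆P′ , P′⊆P) (vs , len , vs⊆P , independent , spans) =
  vs , len , All.map (P⊆P′ _) vs⊆P , independent , λ v → spans v ∘ P′⊆P v

-- Yseq never consults the equality of the ambient space, so it defines the same predicates on X
-- and on X/U; Agda only has to be walked through the recursion to see this.
module _ {R : CommutativeRing 0ℓ 0ℓ} (X : Raw R) (U : Pred X) (Y : Pred X)
         (T : Raw.Carrier X → Raw.Carrier X) where
  private
    Q = quot X U

  Yseq-quot⁺ : ∀ i v → Yseq X Y T i v → Yseq Q Y T i v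
  Yseq-quot⁺ 0                 v y       = y
  Yseq-quot⁺ 1                 v y       = y
  Yseq-quot⁺ (ℕ.suc (ℕ.suc i)) v (y , z) = Yseq-quot⁺ (ℕ.suc i) v y , Yseq-quot⁺ (ℕ.suc i) (T v) z

  Yseq-quot⁻ : ∀ i v → Yseq Q Y T i v → Yseq X Y T i v
  Yseq-quot⁻ 0                 v y       = y
  Yseq-quot⁻ 1                 v y       = y
  Yseq-quot⁻ (ℕ.suc (ℕ.suc i)) v (y , z) = Yseq-quot⁻ (ℕ.suc i) v y , Yseq-quot⁻ (ℕ.suc i) (T v) z

  Yseq-≐-quot⁺ : ∀ i j → _≐_ X (Yseq X Y T i) (Yseq X Y T j) → _≐_ Q (Yseq Q Y T i) (Yseq Q Y T j)
  Yseq-≐-quot⁺ i j (i⊆j , j⊆i) =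
    (λ v → Yseq-quot⁺ j v ∘ i⊆j v ∘ Yseq-quot⁻ i v) , (λ v → Yseq-quot⁺ i v ∘ j⊆i v ∘ Yseq-quot⁻ j v)

  Yseq-≐-quot⁻ : ∀ i j → _≐_ Q (Yseq Q Y T i) (Yseq Q Y T j) → _≐_ X (Yseq X Y T i) (Yseq X Y T j)
  Yseq-≐-quot⁻ i j (i⊆j , j⊆i) =
    (λ v → Yseq-quot⁻ j v ∘ i⊆j v ∘ Yseq-quot⁺ i v) , (λ v → Yseq-quot⁻ i v ∘ j⊆i v ∘ Yseq-quot⁺ j v)

  IsStabIndex-quot : ∀ {ℓ} → IsStabIndex X Y T ℓ → IsStabIndex Q Y T ℓ
  IsStabIndex-quot {ℓ} (stable , unstable) =
    Yseq-≐-quot⁺ ℓ (ℕ.suc ℓ) stable , λ i i<ℓ → unstable i i<ℓ ∘ Yseq-≐-quot⁻ i (ℕ.suc i)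

  Yseq-quot-dim : ∀ i {a} → HasDim Q (Yseq X Y T i) a → HasDim Q (Yseq Q Y T i) a
  Yseq-quot-dim i = HasDim-≐ Q (Yseq-quot⁺ i , Yseq-quot⁻ i)

module Reduction {R : CommutativeRing 0ℓ 0ℓ} (V : Module R 0ℓ 0ℓ) (W : Subspace (toRaw V))
                 (T : Module.Carrierᴹ V → Module.Carrierᴹ V) (linear : IsLinear V T) where
  open Module V using (_≈ᴹ_; 0ᴹ; _+ᴹ_; _*ₗ_; ≈ᴹ-sym)
  open Combinations V using (X; x-0≈x; quot-Subspace⇒Subspace; U⊆quot-Subspace)
  open LeftModuleMorphisms (Module.rawLeftModule V) (Module.rawLeftModule V)
  open IsLeftModuleHomomorphism linear using (⟦⟧-cong; 0ᴹ-homo; +ᴹ-homo; *ₗ-homo)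

  Y : ℕ → Pred X
  Y = Yseq X (pred W) T

  Y-resp : ∀ i {x y} → x ≈ᴹ y → Y i x → Y i y
  Y-resp 0                 x≈y _       = tt
  Y-resp 1                 x≈y x∈W     = resp W x≈y x∈W
  Y-resp (ℕ.suc (ℕ.suc i)) x≈y (x∈ , Tx∈) =
    Y-resp (ℕ.suc i) x≈y x∈ , Y-resp (ℕ.suc i) (⟦⟧-cong x≈y) Tx∈

  Y-0 : ∀ i → Y i 0ᴹ
  Y-0 0                 = tt
  Y-0 1                 = has0 W
  Y-0 (ℕ.suc (ℕ.suc i)) = Y-0 (ℕ.suc i) , Y-resp (ℕ.suc i) (≈ᴹ-sym 0ᴹ-homo) (Y-0 (ℕ.suc i))

  Y-+ : ∀ i {x y} → Y i x → Y i y → Y i (x +ᴹ y)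
  Y-+ 0                 _          _          = tt
  Y-+ 1                 x∈W        y∈W        = add W x∈W y∈W
  Y-+ (ℕ.suc (ℕ.suc i)) (x∈ , Tx∈) (y∈ , Ty∈) =
    Y-+ (ℕ.suc i) x∈ y∈ , Y-resp (ℕ.suc i) (≈ᴹ-sym (+ᴹ-homo _ _)) (Y-+ (ℕ.suc i) Tx∈ Ty∈)

  Y-* : ∀ i c {x} → Y i x → Y i (c *ₗ x)
  Y-* 0                 c _          = tt
  Y-* 1                 c x∈W        = scal W c x∈W
  Y-* (ℕ.suc (ℕ.suc i)) c (x∈ , Tx∈) =
    Y-* (ℕ.suc i) c x∈ , Y-resp (ℕ.suc i) (≈ᴹ-sym (*ₗ-homo c _)) (Y-* (ℕ.suc i) c Tx∈)

  Y-Subspace : ℕ → Subspace X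
  Y-Subspace i = record { pred = Y i ; resp = Y-resp i ; has0 = Y-0 i ; add = Y-+ i ; scal = Y-* i }

  Y⊆W : ∀ i v → Y (ℕ.suc i) v → pred W v
  Y⊆W 0         v v∈W      = v∈W
  Y⊆W (ℕ.suc i) v (v∈ , _) = Y⊆W i v v∈

  module ByMaximalInvariant (U : Subspace X) (maxU : IsMaxInvariant X (pred W) T U) where
    private
      Q = quot X (pred U)

      maximal : ∀ (S : Subspace X) → (∀ v → pred S v → pred W v) → (∀ v → pred S v → pred S (T v)) →
                ∀ v → pred S v → pred U v
      maximal = proj₂ (proj₂ maxU)

    U⊆Y : ∀ i v → pred U v → Y i v
    U⊆Y 0                 v v∈U = tt
    U⊆Y 1                 v v∈U = proj₁ maxU v v∈U
    U⊆Y (ℕ.suc (ℕ.suc i)) v v∈U = U⊆Y (ℕ.suc i) v v∈U , U⊆Y (ℕ.suc i) (T v) (proj₁ (proj₂ maxU) v v∈U)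

    -- At the stable index Y_ℓ is T-invariant; ℓ = 0 is impossible since Y₀ = V ≠ W = Y₁.
    Y⊆U : ¬ (∀ v → pred W v) → ∀ {ℓ} → IsStabIndex X (pred W) T ℓ → ∀ v → Y ℓ v → pred U v
    Y⊆U W≠V {0}       (stable , _) = ⊥-elim (W≠V λ v → proj₁ stable v tt)
    Y⊆U W≠V {ℕ.suc i} (stable , _) = maximal (Y-Subspace (ℕ.suc i)) (Y⊆W i) (λ v → proj₂ ∘ proj₁ stable v)

    quot-Simple : Simple Q (pred W) T
    quot-Simple S S⊆W S-invariant = inj₁
      ( (λ v v∈S → resp U (≈ᴹ-sym (x-0≈x v)) (maximal (quot-Subspace⇒Subspace U S) S⊆W S-invariant v v∈S))
      , (λ v v≈0 → U⊆quot-Subspace U S v (resp U (x-0≈x v) v≈0)) )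

    -- Y_ℓ ⊆ U makes Y_ℓ/U zero, so the empty lists of factors and generators witness I = [].
    quot-InvFactors : ¬ (∀ v → pred W v) → ∀ {ℓ} → IsStabIndex X (pred W) T ℓ → InvFactors Q (pred W) T []
    quot-InvFactors W≠V {ℓ} stable =
      ℓ , IsStabIndex-quot X (pred U) (pred W) T stable , [] , Linked.[] , [] , refl , [] ,
      ([] , (λ _ _ ()) , λ v v∈Y → (λ ()) ,
         resp U (≈ᴹ-sym (x-0≈x v)) (Y⊆U W≠V stable v (Yseq-quot⁻ X (pred U) (pred W) T ℓ v v∈Y)))

    quot-DefectDims : IsField R → ∀ {q} → HasSize R q → ∀ {n} → HasDim X (Full X) n →
                      ∀ {d} → HasDim X (pred U) d → ∀ {λs} →
                      DefectDims X (pred W) T λs → DefectDims Q (pred W) T λs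
    quot-DefectDims isField size dimV {d} dimU {λs} (ℓ , stable , len , dims) =
      ℓ , IsStabIndex-quot X (pred U) (pred W) T stable , len , λ i → quot-step i (dims i)
      where
      open FiniteDimension R isField size V using (quotient-dim)

      quot-dim : ∀ i {a} → HasDim X (Y i) a → ∃ λ a′ → HasDim Q (Yseq Q (pred W) T i) a′ × a′ + d ≡ a
      quot-dim i dimY with quotient-dim dimV U (Y-Subspace i) (U⊆Y i) dimU dimY
      ... | a′ , dimY/U , a′+d≡a = a′ , Yseq-quot-dim X (pred U) (pred W) T i dimY/U , a′+d≡a

      quot-step : ∀ i →
                  (∃₂ λ a b → HasDim X (Y (toℕ i)) a × HasDim X (Y (ℕ.suc (toℕ i))) b × lookup λs i + b ≡ a) →
                  ∃₂ λ a b → HasDim Q (Yseq Q (pred W) T (toℕ i)) a ×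
                             HasDim Q (Yseq Q (pred W) T (ℕ.suc (toℕ i))) b × lookup λs i + b ≡ a
      quot-step i (a , b , dimYᵢ , dimYᵢ₊₁ , λᵢ+b≡a)
        with quot-dim (toℕ i) dimYᵢ | quot-dim (ℕ.suc (toℕ i)) dimYᵢ₊₁
      ... | a′ , dimYᵢ/U , a′+d≡a | b′ , dimYᵢ₊₁/U , b′+d≡b =
        a′ , b′ , dimYᵢ/U , dimYᵢ₊₁/U , difference-invariant d a′+d≡a b′+d≡b λᵢ+b≡a

mainTheorem9 : (q : ℕ) (R : CommutativeRing 0ℓ 0ℓ) → IsField R → HasSize R q →
    (n : ℕ) (V : Module R 0ℓ 0ℓ) → HasDim (toRaw V) (Full (toRaw V)) n →
    (W : Subspace (toRaw V)) → ¬ (∀ v → pred W v) →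
    (T : Module.Carrierᴹ V → Module.Carrierᴹ V) → IsLinear V T →
    (U : Subspace (toRaw V)) → IsMaxInvariant (toRaw V) (pred W) T U →
    (d : ℕ) → HasDim (toRaw V) (pred U) d →
    (λs : List ℕ) (I : List (Poly (toRaw V))) → IsPartition λs (n ∸ d) →
    InClass (toRaw V) (pred W) T λs I →
    Simple (quot (toRaw V) (pred U)) (pred W) T
    × InClass (quot (toRaw V) (pred U)) (pred W) T λs []
mainTheorem9 q R isField size n V dimV W W≠V T linear U maxU d dimU λs I _ (defects@(_ , stable , _) , _) =
  quot-Simple , quot-DefectDims isField size dimV dimU {λs} defects , quot-InvFactors W≠V stable
  where open Reduction.ByMaximalInvariant V W T linear U maxU
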